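{- Let $n,d\ge2$ with $n\ge d-1$. The total number of $(d-1)$-plateaux, summed over all $\Pi\in S^d_n$, equals \[(n-d+2)\,(d-1)!\,\big((n-d+1)!\big)^{d-1}\sum_{\ell=0}^{n-1}\big(A(\ell,d-2)\big)^{d-1},\] where $A(m,k)=\frac{m!}{(m-k)!}$ if $0\le k\le m$ and $A(m,k)=0$ otherwise.
   Context: For $n\ge1$, $S_n$ is the set of permutations of $\{0,\dots,n-1\}$ in one-line notation. For $d\ge2$, $S^d_n$ is the set of $(d-1)$-tuples $\Pi=(\pi^2,\dots,\pi^d)$ of elements of $S_n$; its elements are the columns $\Pi_j=(\pi^2_j,\dots,\pi^d_j)^T$, with level $\mathrm{lev}(\Pi_j)=\max\{\pi^2_j,\dots,\pi^d_j\}$. A $(d-1)$-plateau of $\Pi$ (occurrence of the consecutive pattern $\underline{11\cdots1}$ with $d-1$ ones) is an index $i$ with $1\le i\le n-d+2$ such that $\mathrm{lev}(\Pi_i)=\mathrm{lev}(\Pi_{i+1})=\dots=\mathrm{lev}(\Pi_{i+d-2})$. -}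

module Defs where

open import Data.Nat using (ℕ; zero; suc; _+_; _*_; _∸_; _^_; _⊔_; _≟_)
open import Data.Nat.Combinatorics using (_P_)
open import Data.Fin using (Fin; toℕ)
open import Data.Vec using (Vec; []; _∷_; lookup; toList)
open import Data.Nat.ListAction using (sum)
open import Data.List using (List; []; _∷_; map; concatMap; filter; length; upTo; take; drop; foldr; allFin)
open import Data.List.Relation.Unary.All using (All)
open import Data.List.Relation.Unary.All using () renaming (all? to all?)
open import Data.List.Relation.Unary.Unique.Propositional using (Unique)
open import Data.Bool using (Bool; true; false; if_then_else_)
open import Relation.Nullary.Decidable using (does)
open import Relation.Binary.PropositionalEquality using (_≡_)
import Data.Vec
import Data.Bool
import Data.List.Relation.Unary.All
import Data.Fin.Properties as FinP
import Data.List.Relation.Unary.Unique.DecPropositional as UD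

-- A(m,k) = m!/(m-k)! if k ≤ m, 0 otherwise.  The stdlib's  m P k  is
-- defined exactly this way (falling factorial if k ≤ m, else 0).
A : ℕ → ℕ → ℕ
A m k = m P k

allVecs : (k m : ℕ) → List (Vec (Fin m) k)
allVecs zero    m = [] ∷ []
allVecs (suc k) m = concatMap (λ x → map (x ∷_) (allVecs k m)) (allFin m)

IsPerm : {n : ℕ} → Vec (Fin n) n → Set
IsPerm v = Unique (toList v)

isPerm? : {n : ℕ} → (v : Vec (Fin n) n) → Bool
isPerm? {n} v = does (UD.unique? FinP._≟_ (toList v))

-- S_n : the list of all permutations of {0,…,n-1} in one-line notation (each exactly once).
Sn : (n : ℕ) → List (Vec (Fin n) n)
Sn n = filter (λ v → UD.unique? FinP._≟_ (toList v)) (allVecs n n)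

tuples : {A : Set} → (k : ℕ) → List A → List (Vec A k)
tuples zero    xs = [] ∷ []
tuples (suc k) xs = concatMap (λ x → map (x ∷_) (tuples k xs)) xs

-- S^d_n : all (d-1)-tuples (π², …, π^d) of permutations in S_n.
Snd : (n d : ℕ) → List (Vec (Vec (Fin n) n) (d ∸ 1))
Snd n d = tuples (d ∸ 1) (Sn n)

lev : {n k : ℕ} → Vec (Vec (Fin n) n) k → Fin n → ℕ
lev Π j = foldr _⊔_ 0 (toList (Data.Vec.map (λ π → toℕ (lookup π j)) Π))

levels : {n k : ℕ} → Vec (Vec (Fin n) n) k → List ℕ
levels {n} Π = map (lev Π) (allFin n)

allEqual : List ℕ → Bool
allEqual []       = true
allEqual (x ∷ xs) = does (Data.List.Relation.Unary.All.all? (λ y → y ≟ x) xs)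

-- number of (d-1)-plateaux of Π: the number of (0-indexed) positions i with
-- i + (d-1) ≤ n (i.e. 1-indexed 1 ≤ i+1 ≤ n-d+2) such that the d-1 consecutive
-- levels lev(Π_i), …, lev(Π_{i+d-2}) are all equal.
plateaux : (n d : ℕ) → Vec (Vec (Fin n) n) (d ∸ 1) → ℕ
plateaux n d Π =
  length (filter (λ i → Data.Bool._≟_ (allEqual (take (d ∸ 1) (drop i (levels Π)))) true)
                 (upTo ((n + 1) ∸ (d ∸ 1))))

totalPlateaux : (n d : ℕ) → ℕ
totalPlateaux n d = sum (map (plateaux n d) (Snd n d))

-- Swapping sums, the total is the sum over the n − d + 2 windows of d − 1 consecutive columns of
-- the number of tuples whose levels are constant on the window, and that number does not depend
-- on the window. Fix a window W of size k = d − 1 and a level ℓ. A permutation takes the value ℓ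
-- exactly once, so for all columns of W to have maximum ℓ, the k permutations must put ℓ at k
-- distinct positions of W and stay below ℓ elsewhere on W: k! ways to match permutations with
-- positions, times, for each permutation, A(ℓ, k − 1) · (n − k)! choices (ℓ at its position, the
-- other k − 1 values of W below ℓ, the rest arbitrary). That last count is found by filling a
-- permutation entry by entry while tracking how many unused values lie below, at and above ℓ.

module Submission where

open import Data.Nat using (ℕ; zero; suc; _+_; _*_; _∸_; _^_; _⊓_; _≤_; _<_; _!; z≤n; s≤s; s≤s⁻¹)
import Data.Nat as ℕ
open import Data.Nat.Properties
open import Data.Nat.ListAction using (sum)
open import Data.Nat.Combinatorics using (_P_; k>n⇒nPk≡0; nPn≡n!)
open import Data.Nat.Combinatorics.Base using (_P′_)
open import Data.Nat.Tactic.RingSolver using (solve-∀)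
open import Data.Bool using (Bool; true; false; _∧_; not; if_then_else_; T)
import Data.Bool as Bool
open import Data.Bool.Properties using (T-≡; T-∧; ∧-identityʳ)
open import Data.Unit using (tt)
open import Data.Product using (_×_; _,_; proj₁; proj₂)
open import Data.Sum using (inj₁; inj₂)
open import Data.Fin using (Fin; zero; suc; toℕ)
import Data.Fin.Properties as Fin
open import Data.Vec using (Vec; []; _∷_; lookup; toList)
import Data.Vec.Relation.Unary.All as VecAll
import Data.Vec.Relation.Unary.All.Properties as VecAllₚ
import Data.Vec.Relation.Unary.Any as VecAny
open VecAny using (here; there)
import Data.Vec.Relation.Unary.Unique.Propositional as VecUnique
open import Data.Vec.Relation.Unary.Unique.Propositional.Properties using (lookup-injective)
open import Data.List using (List; []; _∷_; map; concatMap; filter; length; null; allFin; upTo; take; drop; _++_)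
open import Data.List.Properties
  using (map-tabulate; length-tabulate; take-map; drop-map; length-take; length-drop; length-upTo)
open import Data.List.Membership.Propositional using (_∈_; _∉_)
open import Data.List.Membership.Propositional.Properties
  using (∈-allFin; ∈-filter⁻; ∈-filter⁺; ∈-upTo⁺; ∈-upTo⁻)
import Data.List.Membership.DecPropositional as DecMembership
open import Data.List.Relation.Unary.Any using (here; there)
open import Data.List.Relation.Unary.All using (All; []; _∷_; all?)
import Data.List.Relation.Unary.All as All
open import Data.List.Relation.Unary.All.Properties using (all-filter)
open import Data.List.Relation.Unary.Unique.Propositional using (Unique; []; _∷_)
open import Data.List.Relation.Unary.Unique.Propositional.Properties using (allFin⁺; upTo⁺; take⁺; drop⁺; filter⁺)
import Data.List.Relation.Unary.Unique.DecPropositional as UniqueDec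
open import Function using (_∘_; _∘′_; _⇔_; mk⇔; Equivalence)
open import Relation.Unary using (Decidable)
open import Relation.Unary.Properties using (∁?)
open import Relation.Binary using (DecidableEquality)
open import Relation.Nullary using (Dec; does; yes; no; ¬_; contradiction)
open import Relation.Nullary.Decidable using (dec-true; dec-false)
open import Relation.Binary.PropositionalEquality
open import Defs

-- Indicators and finite sums

𝟙 : Bool → ℕ
𝟙 true  = 1
𝟙 false = 0

𝟙-∧ : ∀ a b → 𝟙 (a ∧ b) ≡ 𝟙 a * 𝟙 b
𝟙-∧ true  b = sym (+-identityʳ (𝟙 b))
𝟙-∧ false b = refl

T-ext : ∀ {a b} → (T a → T b) → (T b → T a) → a ≡ b
T-ext {true}  {true}  _ _ = refl
T-ext {true}  {false} f _ = contradiction (f tt) λ ()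
T-ext {false} {true}  _ g = contradiction (g tt) λ ()
T-ext {false} {false} _ _ = refl

T-does⇔ : ∀ {A : Set} (a? : Dec A) → T (does a?) ⇔ A
T-does⇔ (yes a) = mk⇔ (λ _ → a) (λ _ → tt)
T-does⇔ (no ¬a) = mk⇔ (λ ()) ¬a

∑ : {A : Set} → List A → (A → ℕ) → ℕ
∑ xs f = sum (map f xs)

∑-zero : ∀ {A : Set} (xs : List A) → ∑ xs (λ _ → 0) ≡ 0
∑-zero []       = refl
∑-zero (x ∷ xs) = ∑-zero xs

module _ {A : Set} where

  ∑-cong : ∀ (xs : List A) {f g : A → ℕ} → (∀ x → f x ≡ g x) → ∑ xs f ≡ ∑ xs g
  ∑-cong []       f≗g = refl
  ∑-cong (x ∷ xs) f≗g = cong₂ _+_ (f≗g x) (∑-cong xs f≗g)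

  ∑-cong-∈ : ∀ (xs : List A) {f g : A → ℕ} → (∀ {x} → x ∈ xs → f x ≡ g x) → ∑ xs f ≡ ∑ xs g
  ∑-cong-∈ []       f≗g = refl
  ∑-cong-∈ (x ∷ xs) f≗g = cong₂ _+_ (f≗g (here refl)) (∑-cong-∈ xs (f≗g ∘ there))

  ∑-++ : ∀ (xs ys : List A) f → ∑ (xs ++ ys) f ≡ ∑ xs f + ∑ ys f
  ∑-++ []       ys f = refl
  ∑-++ (x ∷ xs) ys f = trans (cong (f x +_) (∑-++ xs ys f)) (sym (+-assoc (f x) _ _))

  ∑-+ : ∀ (xs : List A) f g → ∑ xs (λ x → f x + g x) ≡ ∑ xs f + ∑ xs g
  ∑-+ []       f g = refl
  ∑-+ (x ∷ xs) f g rewrite ∑-+ xs f g = interchange (f x) (g x) _ _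
    where
    interchange : ∀ a b c d → (a + b) + (c + d) ≡ (a + c) + (b + d)
    interchange = solve-∀

  ∑-*ˡ : ∀ (xs : List A) c f → ∑ xs (λ x → c * f x) ≡ c * ∑ xs f
  ∑-*ˡ []       c f = sym (*-zeroʳ c)
  ∑-*ˡ (x ∷ xs) c f rewrite ∑-*ˡ xs c f = sym (*-distribˡ-+ c (f x) _)

  ∑-*ʳ : ∀ (xs : List A) c f → ∑ xs (λ x → f x * c) ≡ ∑ xs f * c
  ∑-*ʳ xs c f = trans (∑-cong xs (λ x → *-comm (f x) c)) (trans (∑-*ˡ xs c f) (*-comm c _))

  ∑-const : ∀ (xs : List A) c → ∑ xs (λ _ → c) ≡ length xs * c
  ∑-const []       c = refl
  ∑-const (x ∷ xs) c = cong (c +_) (∑-const xs c)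

  ∑-filter : ∀ {P : A → Set} (P? : Decidable P) xs f →
    ∑ (filter P? xs) f ≡ ∑ xs (λ x → 𝟙 (does (P? x)) * f x)
  ∑-filter P? []       f = refl
  ∑-filter P? (x ∷ xs) f with does (P? x)
  ... | true  = cong₂ _+_ (sym (+-identityʳ (f x))) (∑-filter P? xs f)
  ... | false = ∑-filter P? xs f

  length-filter-∑ : ∀ {P : A → Set} (P? : Decidable P) xs →
    length (filter P? xs) ≡ ∑ xs (λ x → 𝟙 (does (P? x)))
  length-filter-∑ P? []       = refl
  length-filter-∑ P? (x ∷ xs) with does (P? x)
  ... | true  = cong suc (length-filter-∑ P? xs)
  ... | false = length-filter-∑ P? xs

  module _ (_≟_ : DecidableEquality A) where

    ∑-𝟙-≟ : ∀ {xs} {a} → Unique xs → a ∈ xs → ∑ xs (λ x → 𝟙 (does (x ≟ a))) ≡ 1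
    ∑-𝟙-≟ {x ∷ xs} {a} (x∉xs ∷ u) (here refl) =
      cong₂ _+_ (cong 𝟙 (dec-true (x ≟ x) refl))
                (trans (∑-cong-∈ xs (λ y∈xs → cong 𝟙 (dec-false (_ ≟ x) (All.lookup x∉xs y∈xs ∘ sym))))
                       (∑-zero xs))
    ∑-𝟙-≟ {x ∷ xs} {a} (x∉xs ∷ u) (there a∈xs) =
      cong₂ _+_ (cong 𝟙 (dec-false (x ≟ a) (λ { refl → All.lookup x∉xs a∈xs refl }))) (∑-𝟙-≟ u a∈xs)

    ∑-𝟙-∈? : ∀ {xs ys} → Unique xs → Unique ys → (∀ {y} → y ∈ ys → y ∈ xs) →
      ∑ xs (λ x → 𝟙 (does (DecMembership._∈?_ _≟_ x ys))) ≡ length ys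
    ∑-𝟙-∈? {xs} {[]}     _  _          _     = ∑-zero xs
    ∑-𝟙-∈? {xs} {y ∷ ys} ux (y∉ys ∷ uy) ys⊆xs =
      trans (∑-cong xs pointwise)
            (trans (∑-+ xs _ _)
                   (cong₂ _+_ (∑-𝟙-≟ ux (ys⊆xs (here refl))) (∑-𝟙-∈? ux uy (ys⊆xs ∘ there))))
      where
      pointwise : ∀ x → 𝟙 (does (DecMembership._∈?_ _≟_ x (y ∷ ys)))
                      ≡ 𝟙 (does (x ≟ y)) + 𝟙 (does (DecMembership._∈?_ _≟_ x ys))
      pointwise x with x ≟ y
      ... | yes refl rewrite dec-false (DecMembership._∈?_ _≟_ x ys) (λ x∈ys → All.lookup y∉ys x∈ys refl) = refl
      ... | no  _    = refl

module _ {A B : Set} where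

  ∑-map : ∀ (xs : List A) (g : A → B) f → ∑ (map g xs) f ≡ ∑ xs (f ∘ g)
  ∑-map []       g f = refl
  ∑-map (x ∷ xs) g f = cong (f (g x) +_) (∑-map xs g f)

  ∑-swap : ∀ (xs : List A) (ys : List B) (f : A → B → ℕ) →
    ∑ xs (λ x → ∑ ys (f x)) ≡ ∑ ys (λ y → ∑ xs (λ x → f x y))
  ∑-swap []       ys f = sym (∑-zero ys)
  ∑-swap (x ∷ xs) ys f = trans (cong (∑ ys (f x) +_) (∑-swap xs ys f)) (sym (∑-+ ys (f x) _))

∑-concatMap : ∀ {A B C : Set} (xs : List A) (ys : List B) (g : A → B → C) f →
  ∑ (concatMap (λ x → map (g x) ys) xs) f ≡ ∑ xs (λ x → ∑ ys (f ∘ g x))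
∑-concatMap []       ys g f = refl
∑-concatMap (x ∷ xs) ys g f =
  trans (∑-++ (map (g x) ys) _ f) (cong₂ _+_ (∑-map ys (g x) f) (∑-concatMap xs ys g f))

∑-allFin-suc : ∀ n f → ∑ (allFin (suc n)) f ≡ f zero + ∑ (allFin n) (f ∘ suc)
∑-allFin-suc n f =
  cong (f zero +_) (trans (cong sum (map-tabulate suc f)) (sym (cong sum (map-tabulate (λ i → i) (f ∘ suc)))))

∑-mono-≤ : ∀ {A : Set} (xs : List A) {f g : A → ℕ} → (∀ x → f x ≤ g x) → ∑ xs f ≤ ∑ xs g
∑-mono-≤ []       f≤g = z≤n
∑-mono-≤ (x ∷ xs) f≤g = +-mono-≤ (f≤g x) (∑-mono-≤ xs f≤g)

𝟙-∧-≤ : ∀ a b → 𝟙 (a ∧ b) ≤ 𝟙 a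
𝟙-∧-≤ true  true  = ≤-refl
𝟙-∧-≤ true  false = z≤n
𝟙-∧-≤ false b     = z≤n

length-filter+∁ : ∀ {A : Set} {P : A → Set} (P? : Decidable P) xs →
  length (filter P? xs) + length (filter (∁? P?) xs) ≡ length xs
length-filter+∁ P? []       = refl
length-filter+∁ P? (x ∷ xs) with does (P? x)
... | true  = cong suc (length-filter+∁ P? xs)
... | false = trans (+-suc _ _) (cong suc (length-filter+∁ P? xs))

length≤1-of-fiber : ∀ {A B : Set} {f : A → B} {c : B} {xs : List A} → (∀ {x y} → f x ≡ f y → x ≡ y) →
  Unique xs → All (λ x → f x ≡ c) xs → length xs ≤ 1
length≤1-of-fiber {xs = []}         _   _                  _                = z≤n
length≤1-of-fiber {xs = _ ∷ []}     _   _                  _                = s≤s z≤n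
length≤1-of-fiber {xs = _ ∷ _ ∷ _} inj ((x≢y ∷ _) ∷ _) (fx≡c ∷ fy≡c ∷ _) =
  contradiction (inj (trans fx≡c (sym fy≡c))) x≢y

all?-map : ∀ {A B : Set} {P : B → Set} (P? : Decidable P) (f : A → B) xs →
  does (All.all? P? (map f xs)) ≡ does (All.all? (P? ∘ f) xs)
all?-map P? f []       = refl
all?-map P? f (x ∷ xs) = cong (does (P? (f x)) ∧_) (all?-map P? f xs)

-- Falling factorials and arrangement numbers

infixl 8 _↓_

_↓_ : ℕ → ℕ → ℕ
m     ↓ zero  = 1
zero  ↓ suc k = 0
suc m ↓ suc k = suc m * m ↓ k

↓-suc : ∀ m k → m ↓ suc k ≡ (m ∸ k) * m ↓ k
↓-suc zero    zero    = refl
↓-suc (suc m) zero    = refl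
↓-suc zero    (suc k) = refl
↓-suc (suc m) (suc k) rewrite ↓-suc m k = x*[y*z]≡y*[x*z] (suc m) (m ∸ k) (m ↓ k)
  where
  x*[y*z]≡y*[x*z] : ∀ x y z → x * (y * z) ≡ y * (x * z)
  x*[y*z]≡y*[x*z] = solve-∀

↓-zero : ∀ {m k} → m < k → m ↓ k ≡ 0
↓-zero {zero}  {suc k} m<k       = refl
↓-zero {suc m} {suc k} (s≤s m<k) rewrite ↓-zero m<k = *-zeroʳ (suc m)

↓≡P : ∀ m k → m ↓ k ≡ m P k
↓≡P m k with k ≤? m
... | yes k≤m rewrite Equivalence.to T-≡ (≤⇒≤ᵇ k≤m) = ↓≡P′ k
  where
  ↓≡P′ : ∀ k → m ↓ k ≡ m P′ k
  ↓≡P′ zero    = refl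
  ↓≡P′ (suc k) = trans (↓-suc m k) (cong ((m ∸ k) *_) (↓≡P′ k))
... | no k≰m = trans (↓-zero (≰⇒> k≰m)) (sym (k>n⇒nPk≡0 (≰⇒> k≰m)))

^-distribʳ-* : ∀ a b k → (a * b) ^ k ≡ a ^ k * b ^ k
^-distribʳ-* a b zero    = refl
^-distribʳ-* a b (suc k) rewrite ^-distribʳ-* a b k = interchange a b (a ^ k) (b ^ k)
  where
  interchange : ∀ a b x y → a * b * (x * y) ≡ a * x * (b * y)
  interchange = solve-∀

-- arr₂ a h p q counts injective fillings of p slots that need a low value and q unrestricted
-- slots, from a low and h high values.
arr₂ : (a h p q : ℕ) → ℕ
arr₂ a       h zero    q = (a + h) ↓ q
arr₂ zero    h (suc p) q = 0
arr₂ (suc a) h (suc p) q = suc a * arr₂ a h p q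

arr₂-low : ∀ a h p q → a * arr₂ (a ∸ 1) h p q ≡ arr₂ a h (suc p) q
arr₂-low zero    h p q = refl
arr₂-low (suc a) h p q = refl

arr₂-free : ∀ a h p q → a * arr₂ (a ∸ 1) h p q + h * arr₂ a (h ∸ 1) p q ≡ arr₂ a h p (suc q)
arr₂-free zero    zero    zero q = refl
arr₂-free zero    (suc h) zero q = refl
arr₂-free (suc a) zero    zero q rewrite +-identityʳ a = +-identityʳ _
arr₂-free (suc a) (suc h) zero q rewrite +-suc a h = distrib a h (suc (a + h) ↓ q)
  where
  distrib : ∀ a h x → suc a * x + suc h * x ≡ suc (suc (a + h)) * x
  distrib = solve-∀
arr₂-free zero    h (suc p) q = *-zeroʳ h
arr₂-free (suc a) h (suc p) q
  rewrite sym (arr₂-free a h p q) | sym (arr₂-low a h p q) =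
  regroup (suc a) (a * arr₂ (a ∸ 1) h p q) h (arr₂ a (h ∸ 1) p q)
  where
  regroup : ∀ s x h y → s * x + h * (s * y) ≡ s * (x + h * y)
  regroup = solve-∀

arr₂-closed : ∀ a h p q → arr₂ a h p q ≡ a ↓ p * (a + h ∸ p) ↓ q
arr₂-closed a       h zero    q = sym (+-identityʳ _)
arr₂-closed zero    h (suc p) q = refl
arr₂-closed (suc a) h (suc p) q rewrite arr₂-closed a h p q = sym (*-assoc (suc a) (a ↓ p) _)

-- arr₃ also has o slots that need the value ℓ itself, and splits the low values into c below ℓ
-- and b copies of ℓ. It is only meaningful for b ≤ 1, which is why two such slots give 0.
arr₃ : (o p q c b h : ℕ) → ℕ
arr₃ zero          p q c b h = arr₂ (c + b) h p q
arr₃ (suc zero)    p q c b h = b * arr₂ c h p q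
arr₃ (suc (suc o)) p q c b h = 0

pick-from-sum : ∀ (f : ℕ → ℕ) c {b} → b ≤ 1 →
  c * f (c ∸ 1 + b) + b * f (c + (b ∸ 1)) ≡ (c + b) * f (c + b ∸ 1)
pick-from-sum f c z≤n rewrite +-identityʳ c | +-identityʳ (c ∸ 1) = +-identityʳ _
pick-from-sum f zero    (s≤s z≤n) = refl
pick-from-sum f (suc c) (s≤s z≤n) rewrite +-comm c 1 | +-identityʳ c = distrib c (f (suc c))
  where
  distrib : ∀ c x → suc c * x + 1 * x ≡ suc (suc c) * x
  distrib = solve-∀

arr₃-peak : ∀ o p q c {b} h → b ≤ 1 → b * arr₃ o p q c (b ∸ 1) h ≡ arr₃ (suc o) p q c b h
arr₃-peak zero          p q c h z≤n       = refl
arr₃-peak zero          p q c h (s≤s z≤n) = cong (λ x → 1 * arr₂ x h p q) (+-identityʳ c)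
arr₃-peak (suc zero)    p q c h z≤n       = refl
arr₃-peak (suc zero)    p q c h (s≤s z≤n) = refl
arr₃-peak (suc (suc o)) p q c {b} h _     = *-zeroʳ b

arr₃-low : ∀ o p q c {b} h → b ≤ 1 →
  c * arr₃ o p q (c ∸ 1) b h + b * arr₃ o p q c (b ∸ 1) h ≡ arr₃ o (suc p) q c b h
arr₃-low zero          p q c {b} h b≤1 = trans (pick-from-sum (λ a → arr₂ a h p q) c b≤1) (arr₂-low (c + b) h p q)
arr₃-low (suc zero)    p q c h z≤n       rewrite *-zeroʳ c = refl
arr₃-low (suc zero)    p q c h (s≤s z≤n) =
  trans (drop-empty c (arr₂ (c ∸ 1) h p q) (arr₂ c h p q)) (cong (1 *_) (arr₂-low c h p q))
  where
  drop-empty : ∀ c x y → c * (1 * x) + 1 * (0 * y) ≡ 1 * (c * x)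
  drop-empty = solve-∀
arr₃-low (suc (suc o)) p q c {b} h _ rewrite *-zeroʳ c | *-zeroʳ b = refl

arr₃-free : ∀ o p q c {b} h → b ≤ 1 →
  c * arr₃ o p q (c ∸ 1) b h + b * arr₃ o p q c (b ∸ 1) h + h * arr₃ o p q c b (h ∸ 1)
    ≡ arr₃ o p (suc q) c b h
arr₃-free zero          p q c {b} h b≤1 =
  trans (cong (_+ h * arr₂ (c + b) (h ∸ 1) p q) (pick-from-sum (λ a → arr₂ a h p q) c b≤1))
        (arr₂-free (c + b) h p q)
arr₃-free (suc zero)    p q c h z≤n       rewrite *-zeroʳ c | *-zeroʳ h = refl
arr₃-free (suc zero)    p q c h (s≤s z≤n) =
  trans (drop-empty c h (arr₂ (c ∸ 1) h p q) (arr₂ c h p q) (arr₂ c (h ∸ 1) p q))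
        (cong (1 *_) (arr₂-free c h p q))
  where
  drop-empty : ∀ c h x y z → c * (1 * x) + 1 * (0 * y) + h * (1 * z) ≡ 1 * (c * x + h * z)
  drop-empty = solve-∀
arr₃-free (suc (suc o)) p q c {b} h _ rewrite *-zeroʳ c | *-zeroʳ b | *-zeroʳ h = refl

arr₃-cong : ∀ {o o′ p p′ q q′ c c′ b b′ h h′} →
  o ≡ o′ → p ≡ p′ → q ≡ q′ → c ≡ c′ → b ≡ b′ → h ≡ h′ → arr₃ o p q c b h ≡ arr₃ o′ p′ q′ c′ b′ h′
arr₃-cong refl refl refl refl refl refl = refl

-- Positions relative to a level

data Side : Set where
  below at above : Side

_==ˢ_ : Side → Side → Bool
below ==ˢ below = true
at    ==ˢ at    = true
above ==ˢ above = true
_     ==ˢ _     = false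

==ˢ-sound : ∀ {s s′} → s ==ˢ s′ ≡ true → s ≡ s′
==ˢ-sound {below} {below} _ = refl
==ˢ-sound {at}    {at}    _ = refl
==ˢ-sound {above} {above} _ = refl

side : ℕ → ℕ → Side
side zero    zero    = at
side zero    (suc ℓ) = below
side (suc x) zero    = above
side (suc x) (suc ℓ) = side x ℓ

data Slot : Set where
  peak low free : Slot

_==ᵗ_ : Slot → Slot → Bool
peak ==ᵗ peak = true
low  ==ᵗ low  = true
free ==ᵗ free = true
_    ==ᵗ _    = false

fits : Slot → Side → Bool
fits peak at    = true
fits peak _     = false
fits low  above = false
fits low  _     = true
fits free _     = true

count : ∀ {m} → Slot → (Fin m → Slot) → ℕ
count {zero}  t ts = 0
count {suc m} t ts = 𝟙 (ts zero ==ᵗ t) + count t (ts ∘ suc)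

count≡∑ : ∀ {m} t (ts : Fin m → Slot) → count t ts ≡ ∑ (allFin m) (λ j → 𝟙 (ts j ==ᵗ t))
count≡∑ {zero}  t ts = refl
count≡∑ {suc m} t ts =
  trans (cong (𝟙 (ts zero ==ᵗ t) +_) (count≡∑ t (ts ∘ suc))) (sym (∑-allFin-suc m (λ j → 𝟙 (ts j ==ᵗ t))))

fits-peak⇔≡ : ∀ x ℓ → T (fits peak (side x ℓ)) ⇔ x ≡ ℓ
fits-peak⇔≡ zero    zero    = mk⇔ (λ _ → refl) (λ _ → tt)
fits-peak⇔≡ zero    (suc ℓ) = mk⇔ (λ ()) (λ ())
fits-peak⇔≡ (suc x) zero    = mk⇔ (λ ()) (λ ())
fits-peak⇔≡ (suc x) (suc ℓ) = mk⇔ (cong suc ∘ Equivalence.to (fits-peak⇔≡ x ℓ))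
                                  (Equivalence.from (fits-peak⇔≡ x ℓ) ∘ suc-injective)

fits-low⇔≤ : ∀ x ℓ → T (fits low (side x ℓ)) ⇔ x ≤ ℓ
fits-low⇔≤ zero    zero    = mk⇔ (λ _ → z≤n) (λ _ → tt)
fits-low⇔≤ zero    (suc ℓ) = mk⇔ (λ _ → z≤n) (λ _ → tt)
fits-low⇔≤ (suc x) zero    = mk⇔ (λ ()) (λ ())
fits-low⇔≤ (suc x) (suc ℓ) = mk⇔ (s≤s ∘ Equivalence.to (fits-low⇔≤ x ℓ))
                                 (Equivalence.from (fits-low⇔≤ x ℓ) ∘ s≤s⁻¹)

module _ (o p q c b h : ℕ) where

  private
    x y z : ℕ
    x = arr₃ o p q (c ∸ 1) b h
    y = arr₃ o p q c (b ∸ 1) h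
    z = arr₃ o p q c b (h ∸ 1)

  arr₃-recurrence : ∀ t → b ≤ 1 →
    c * (𝟙 (fits t below) * x) + b * (𝟙 (fits t at) * y) + h * (𝟙 (fits t above) * z)
      ≡ arr₃ (𝟙 (t ==ᵗ peak) + o) (𝟙 (t ==ᵗ low) + p) (𝟙 (t ==ᵗ free) + q) c b h
  arr₃-recurrence peak b≤1 = trans (only-middle c b h x y z) (arr₃-peak o p q c h b≤1)
    where
    only-middle : ∀ c b h x y z → c * (0 * x) + b * (1 * y) + h * (0 * z) ≡ b * y
    only-middle = solve-∀
  arr₃-recurrence low  b≤1 = trans (drop-last c b h x y z) (arr₃-low o p q c h b≤1)
    where
    drop-last : ∀ c b h x y z → c * (1 * x) + b * (1 * y) + h * (0 * z) ≡ c * x + b * y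
    drop-last = solve-∀
  arr₃-recurrence free b≤1 = trans (keep-all c b h x y z) (arr₃-free o p q c h b≤1)
    where
    keep-all : ∀ c b h x y z → c * (1 * x) + b * (1 * y) + h * (1 * z) ≡ c * x + b * y + h * z
    keep-all = solve-∀

sideCount : ℕ → ℕ → Side → ℕ
sideCount n ℓ s = ∑ (allFin n) (λ x → 𝟙 (side (toℕ x) ℓ ==ˢ s))

sideCount-suc-zero : ∀ n s → sideCount (suc n) zero s ≡ 𝟙 (at ==ˢ s) + length (allFin n) * 𝟙 (above ==ˢ s)
sideCount-suc-zero n s = trans (∑-allFin-suc n _) (cong (𝟙 (at ==ˢ s) +_) (∑-const (allFin n) _))

sideCount-suc-suc : ∀ n ℓ s → sideCount (suc n) (suc ℓ) s ≡ 𝟙 (below ==ˢ s) + sideCount n ℓ s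
sideCount-suc-suc n ℓ s = ∑-allFin-suc n _

sideCount-at≤1 : ∀ n ℓ → sideCount n ℓ at ≤ 1
sideCount-at≤1 zero    ℓ       = z≤n
sideCount-at≤1 (suc n) zero    rewrite sideCount-suc-zero n at | *-zeroʳ (length (allFin n)) = s≤s z≤n
sideCount-at≤1 (suc n) (suc ℓ) rewrite sideCount-suc-suc n ℓ at = sideCount-at≤1 n ℓ

sideCount-below : ∀ n ℓ → ℓ ≤ n → sideCount n ℓ below ≡ ℓ
sideCount-below zero    zero    _         = refl
sideCount-below (suc n) zero    _         = trans (sideCount-suc-zero n below) (*-zeroʳ (length (allFin n)))
sideCount-below (suc n) (suc ℓ) (s≤s ℓ≤n) =
  trans (sideCount-suc-suc n ℓ below) (cong suc (sideCount-below n ℓ ℓ≤n))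

sideCount-at : ∀ n ℓ → ℓ < n → sideCount n ℓ at ≡ 1
sideCount-at (suc n) zero    _         = trans (sideCount-suc-zero n at) (cong suc (*-zeroʳ (length (allFin n))))
sideCount-at (suc n) (suc ℓ) (s≤s ℓ<n) = trans (sideCount-suc-suc n ℓ at) (sideCount-at n ℓ ℓ<n)

sideCount-above : ∀ n ℓ → ℓ < n → sideCount n ℓ above ≡ n ∸ suc ℓ
sideCount-above (suc n) zero    _         =
  trans (sideCount-suc-zero n above) (trans (*-identityʳ _) (length-tabulate (λ i → i)))
sideCount-above (suc n) (suc ℓ) (s≤s ℓ<n) = trans (sideCount-suc-suc n ℓ above) (sideCount-above n ℓ ℓ<n)

-- Counting injective words

_∈ᵇ_ : ∀ {n} → Fin n → List (Fin n) → Bool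
x ∈ᵇ U = does (DecMembership._∈?_ Fin._≟_ x U)

fresh : ∀ {n m} → List (Fin n) → Vec (Fin n) m → Bool
fresh U []      = true
fresh U (x ∷ v) = not (x ∈ᵇ U) ∧ fresh (x ∷ U) v

module Arrangements (n ℓ : ℕ) where

  σ : Fin n → Side
  σ x = side (toℕ x) ℓ

  fitsᵛ : ∀ {m} → (Fin m → Slot) → Vec (Fin n) m → Bool
  fitsᵛ ts []      = true
  fitsᵛ ts (x ∷ v) = fits (ts zero) (σ x) ∧ fitsᵛ (ts ∘ suc) v

  arrangements : ∀ {m} → (Fin m → Slot) → List (Fin n) → ℕ
  arrangements {m} ts U = ∑ (allVecs m n) (λ v → 𝟙 (fresh U v ∧ fitsᵛ ts v))

  avail : List (Fin n) → Side → ℕ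
  avail U s = ∑ (allFin n) (λ x → 𝟙 (σ x ==ˢ s ∧ not (x ∈ᵇ U)))

  arrangements-step : ∀ {m} (ts : Fin (suc m) → Slot) U →
    arrangements ts U
      ≡ ∑ (allFin n) (λ x → 𝟙 (not (x ∈ᵇ U) ∧ fits (ts zero) (σ x)) * arrangements (ts ∘ suc) (x ∷ U))
  arrangements-step {m} ts U = trans (∑-concatMap (allFin n) (allVecs m n) _∷_ _) (∑-cong (allFin n) first)
    where
    t = ts zero
    𝟙-interchange : ∀ a b c d → 𝟙 ((a ∧ c) ∧ (b ∧ d)) ≡ 𝟙 (a ∧ b) * 𝟙 (c ∧ d)
    𝟙-interchange true  true  c     d = sym (+-identityʳ _)
    𝟙-interchange true  false true  d = refl
    𝟙-interchange true  false false d = refl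
    𝟙-interchange false b     c     d = refl
    first : ∀ x → ∑ (allVecs m n) (λ v → 𝟙 (fresh U (x ∷ v) ∧ fitsᵛ ts (x ∷ v)))
                ≡ 𝟙 (not (x ∈ᵇ U) ∧ fits t (σ x)) * arrangements (ts ∘ suc) (x ∷ U)
    first x = trans (∑-cong (allVecs m n) λ v → 𝟙-interchange a b (fresh (x ∷ U) v) (fitsᵛ (ts ∘ suc) v))
                    (∑-*ˡ (allVecs m n) (𝟙 (a ∧ b)) (λ v → 𝟙 (fresh (x ∷ U) v ∧ fitsᵛ (ts ∘ suc) v)))
      where
      a = not (x ∈ᵇ U)
      b = fits t (σ x)

  avail-∷ : ∀ {x} U → x ∉ U → ∀ s → avail U s ≡ 𝟙 (σ x ==ˢ s) + avail (x ∷ U) s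
  avail-∷ {x} U x∉U s = begin
    avail U s
      ≡⟨ ∑-cong (allFin n) pointwise ⟩
    ∑ (allFin n) (λ y → 𝟙 (does (y Fin.≟ x)) * 𝟙 (σ x ==ˢ s) + 𝟙 (σ y ==ˢ s ∧ not (y ∈ᵇ (x ∷ U))))
      ≡⟨ ∑-+ (allFin n) _ _ ⟩
    ∑ (allFin n) (λ y → 𝟙 (does (y Fin.≟ x)) * 𝟙 (σ x ==ˢ s)) + avail (x ∷ U) s
      ≡⟨ cong (_+ avail (x ∷ U) s) (∑-*ʳ (allFin n) (𝟙 (σ x ==ˢ s)) _) ⟩
    ∑ (allFin n) (λ y → 𝟙 (does (y Fin.≟ x))) * 𝟙 (σ x ==ˢ s) + avail (x ∷ U) s
      ≡⟨ cong (λ k → k * 𝟙 (σ x ==ˢ s) + avail (x ∷ U) s)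
              (∑-𝟙-≟ Fin._≟_ (allFin⁺ n) (∈-allFin x)) ⟩
    1 * 𝟙 (σ x ==ˢ s) + avail (x ∷ U) s
      ≡⟨ cong (_+ avail (x ∷ U) s) (*-identityˡ _) ⟩
    𝟙 (σ x ==ˢ s) + avail (x ∷ U) s ∎
    where
    open ≡-Reasoning
    pointwise : ∀ y → 𝟙 (σ y ==ˢ s ∧ not (y ∈ᵇ U))
                    ≡ 𝟙 (does (y Fin.≟ x)) * 𝟙 (σ x ==ˢ s) + 𝟙 (σ y ==ˢ s ∧ not (y ∈ᵇ (x ∷ U)))
    pointwise y with y Fin.≟ x
    ... | yes refl rewrite dec-false (DecMembership._∈?_ Fin._≟_ y U) x∉U = split (σ y ==ˢ s)
      where
      split : ∀ a → 𝟙 (a ∧ true) ≡ 𝟙 a + 0 + 𝟙 (a ∧ false)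
      split true  = refl
      split false = refl
    ... | no  _    = refl

  avail-after : ∀ {x} U → x ∉ U → ∀ s → avail (x ∷ U) s ≡ avail U s ∸ 𝟙 (σ x ==ˢ s)
  avail-after {x} U x∉U s =
    sym (trans (cong (_∸ 𝟙 (σ x ==ˢ s)) (avail-∷ U x∉U s)) (m+n∸m≡n (𝟙 (σ x ==ˢ s)) _))

  avail-at≤1 : ∀ U → avail U at ≤ 1
  avail-at≤1 U = ≤-trans (∑-mono-≤ (allFin n) (λ x → 𝟙-∧-≤ (σ x ==ˢ at) _)) (sideCount-at≤1 n ℓ)

  module _ (t : Slot) (U : List (Fin n)) (f : ℕ → ℕ → ℕ → ℕ) where

    private
      c b h : ℕ
      c = avail U below
      b = avail U at
      h = avail U above

    extend : Fin n → ℕ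
    extend x =
      𝟙 (not (x ∈ᵇ U) ∧ fits t (σ x)) * f (avail (x ∷ U) below) (avail (x ∷ U) at) (avail (x ∷ U) above)

    shrunk : Side → ℕ
    shrunk s = f (c ∸ 𝟙 (s ==ˢ below)) (b ∸ 𝟙 (s ==ˢ at)) (h ∸ 𝟙 (s ==ˢ above))

    extend-on-side : ∀ s →
      ∑ (allFin n) (λ x → 𝟙 (σ x ==ˢ s) * extend x) ≡ avail U s * (𝟙 (fits t s) * shrunk s)
    extend-on-side s = trans (∑-cong (allFin n) pointwise) (∑-*ʳ (allFin n) _ _)
      where
      pointwise : ∀ x →
        𝟙 (σ x ==ˢ s) * extend x ≡ 𝟙 (σ x ==ˢ s ∧ not (x ∈ᵇ U)) * (𝟙 (fits t s) * shrunk s)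
      pointwise x with σ x ==ˢ s in σx≡s | DecMembership._∈?_ Fin._≟_ x U
      ... | false | _      = refl
      ... | true  | yes _  = refl
      ... | true  | no x∉U
        rewrite avail-after U x∉U below | avail-after U x∉U at | avail-after U x∉U above
              | ==ˢ-sound σx≡s = refl

    extend-by-side : ∑ (allFin n) extend
      ≡ c * (𝟙 (fits t below) * f (c ∸ 1) b h) + b * (𝟙 (fits t at) * f c (b ∸ 1) h)
        + h * (𝟙 (fits t above) * f c b (h ∸ 1))
    extend-by-side =
      trans (∑-cong (allFin n) (λ x → split (σ x) (extend x)))
            (trans (∑-+ (allFin n) _ _)
                   (cong₂ _+_ (trans (∑-+ (allFin n) _ _) (cong₂ _+_ (extend-on-side below) (extend-on-side at)))
                              (extend-on-side above)))
      where
      split : ∀ s y → y ≡ 𝟙 (s ==ˢ below) * y + 𝟙 (s ==ˢ at) * y + 𝟙 (s ==ˢ above) * y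
      split below y = sym (trans (+-identityʳ _) (trans (+-identityʳ _) (+-identityʳ y)))
      split at    y = sym (trans (+-identityʳ _) (+-identityʳ y))
      split above y = sym (+-identityʳ y)

  -- The first letter is an available value on a side allowed by its slot; choosing it lowers
  -- that side's count by one, so arr₃ satisfies the same recurrence.
  arrangements≡arr₃ : ∀ {m} (ts : Fin m → Slot) U →
    arrangements ts U ≡ arr₃ (count peak ts) (count low ts) (count free ts) (avail U below) (avail U at) (avail U above)
  arrangements≡arr₃ {zero}  ts U = refl
  arrangements≡arr₃ {suc m} ts U = begin
    arrangements ts U
      ≡⟨ arrangements-step ts U ⟩
    ∑ (allFin n) (λ x → 𝟙 (not (x ∈ᵇ U) ∧ fits t (σ x)) * arrangements (ts ∘ suc) (x ∷ U))
      ≡⟨ ∑-cong (allFin n) (λ x → cong (𝟙 (not (x ∈ᵇ U) ∧ fits t (σ x)) *_)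
                                       (arrangements≡arr₃ (ts ∘ suc) (x ∷ U))) ⟩
    ∑ (allFin n) (extend t U (arr₃ o p q))
      ≡⟨ extend-by-side t U (arr₃ o p q) ⟩
    _ ≡⟨ arr₃-recurrence o p q (avail U below) (avail U at) (avail U above) t (avail-at≤1 U) ⟩
    arr₃ (count peak ts) (count low ts) (count free ts) (avail U below) (avail U at) (avail U above) ∎
    where
    open ≡-Reasoning
    t = ts zero
    o = count peak (ts ∘ suc)
    p = count low (ts ∘ suc)
    q = count free (ts ∘ suc)

  fitsᵛ⇔ : ∀ {m} (ts : Fin m → Slot) (v : Vec (Fin n) m) →
    T (fitsᵛ ts v) ⇔ (∀ j → T (fits (ts j) (σ (lookup v j))))
  fitsᵛ⇔ ts []      = mk⇔ (λ _ ()) (λ _ → tt)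
  fitsᵛ⇔ ts (x ∷ v) = mk⇔
    (λ h → let (head , rest) = Equivalence.to T-∧ h in
           λ { zero → head ; (suc j) → Equivalence.to (fitsᵛ⇔ (ts ∘ suc) v) rest j })
    (λ h → Equivalence.from T-∧ (h zero , Equivalence.from (fitsᵛ⇔ (ts ∘ suc) v) (h ∘ suc)))

-- Permutations

module _ {n : ℕ} where

  fresh⇔ : ∀ {m} U (v : Vec (Fin n) m) → T (fresh U v) ⇔ (Unique (toList v) × All (_∉ U) (toList v))
  fresh⇔ U []      = mk⇔ (λ _ → [] , []) (λ _ → tt)
  fresh⇔ U (x ∷ v) with DecMembership._∈?_ Fin._≟_ x U
  ... | yes x∈U = mk⇔ (λ ()) (λ { (_ , x∉U ∷ _) → x∉U x∈U })
  ... | no  x∉U = mk⇔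
    (λ h → let (u , ∉x∷U) = Equivalence.to (fresh⇔ (x ∷ U) v) h in
           All.map (λ y∉x∷U x≡y → y∉x∷U (here (sym x≡y))) ∉x∷U ∷ u
           , x∉U ∷ All.map (_∘′ there) ∉x∷U)
    (λ { (x∉v ∷ u , _ ∷ ∉U) → Equivalence.from (fresh⇔ (x ∷ U) v) (u , All.zipWith avoid (x∉v , ∉U)) })
    where
    avoid : ∀ {y} → (¬ x ≡ y) × y ∉ U → y ∉ x ∷ U
    avoid (x≢y , _)   (here y≡x)  = x≢y (sym y≡x)
    avoid (_   , y∉U) (there y∈U) = y∉U y∈U

  fresh[]≡unique? : ∀ {m} (v : Vec (Fin n) m) → fresh [] v ≡ does (UniqueDec.unique? Fin._≟_ (toList v))
  fresh[]≡unique? v = T-ext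
    (λ h → Equivalence.from (T-does⇔ unique?) (proj₁ (Equivalence.to (fresh⇔ [] v) h)))
    (λ h → Equivalence.from (fresh⇔ [] v) (Equivalence.to (T-does⇔ unique?) h , All.universal (λ _ ()) _))
    where
    unique? = UniqueDec.unique? Fin._≟_ (toList v)

  ∑-Sn : ∀ f → ∑ (Sn n) f ≡ ∑ (allVecs n n) (λ v → 𝟙 (fresh [] v) * f v)
  ∑-Sn f = trans (∑-filter _ (allVecs n n) f)
                 (∑-cong (allVecs n n) (λ v → cong (λ b → 𝟙 b * f v) (sym (fresh[]≡unique? v))))

  Sn-injective : ∀ {π} → π ∈ Sn n → ∀ i j → lookup π i ≡ lookup π j → i ≡ j
  Sn-injective {π} π∈Sn =
    lookup-injective (toVecUnique {v = π} (proj₂ (∈-filter⁻ unique? {xs = allVecs n n} π∈Sn)))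
    where
    unique? = λ (v : Vec (Fin n) n) → UniqueDec.unique? Fin._≟_ (toList v)
    toVecUnique : ∀ {m} {v : Vec (Fin n) m} → Unique (toList v) → VecUnique.Unique v
    toVecUnique {v = []}    []        = VecUnique.[]
    toVecUnique {v = _ ∷ _} (x∉ ∷ u) = VecAllₚ.toList⁻ x∉ VecUnique.∷ toVecUnique u

-- Permutations with a prescribed pattern on a window

module PatternCount (n ℓ : ℕ) (W : List (Fin n)) where
  open Arrangements n ℓ

  bounded : Vec (Fin n) n → Bool
  bounded π = does (all? (λ y → toℕ (lookup π y) ≤? ℓ) W)

  peaksAt : Fin n → Vec (Fin n) n → Bool
  peaksAt u π = does (toℕ (lookup π u) ℕ.≟ ℓ)

  bounded⇔ : ∀ π → T (bounded π) ⇔ All (λ y → toℕ (lookup π y) ≤ ℓ) W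
  bounded⇔ π = T-does⇔ (all? (λ y → toℕ (lookup π y) ≤? ℓ) W)

  peaksAt⇔ : ∀ u π → T (peaksAt u π) ⇔ toℕ (lookup π u) ≡ ℓ
  peaksAt⇔ u π = T-does⇔ (toℕ (lookup π u) ℕ.≟ ℓ)

  slot : Fin n → Fin n → Slot
  slot u j = if j ∈ᵇ W then (if does (j Fin.≟ u) then peak else low) else free

  module _ {u : Fin n} (u∈W : u ∈ W) where

    slot-fits⇔ : ∀ j x → T (fits (slot u j) (side x ℓ)) ⇔ ((j ∈ W → x ≤ ℓ) × (j ≡ u → x ≡ ℓ))
    slot-fits⇔ j x with DecMembership._∈?_ Fin._≟_ j W | j Fin.≟ u
    ... | yes _   | yes refl = mk⇔
      (λ h → let x≡ℓ = Equivalence.to (fits-peak⇔≡ x ℓ) h in (λ _ → ≤-reflexive x≡ℓ) , (λ _ → x≡ℓ))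
      (λ (_ , x≡ℓ) → Equivalence.from (fits-peak⇔≡ x ℓ) (x≡ℓ refl))
    ... | yes j∈W | no j≢u  = mk⇔
      (λ h → (λ _ → Equivalence.to (fits-low⇔≤ x ℓ) h) , (λ j≡u → contradiction j≡u j≢u))
      (λ (x≤ℓ , _) → Equivalence.from (fits-low⇔≤ x ℓ) (x≤ℓ j∈W))
    ... | no j∉W  | _       = mk⇔
      (λ _ → (λ j∈W → contradiction j∈W j∉W) , (λ { refl → contradiction u∈W j∉W }))
      (λ _ → tt)

    fitsᵛ-slot : ∀ π → fitsᵛ (slot u) π ≡ bounded π ∧ peaksAt u π
    fitsᵛ-slot π = T-ext
      (λ h → let pointwise = Equivalence.to (fitsᵛ⇔ (slot u) π) h
                 at-j j = Equivalence.to (slot-fits⇔ j (toℕ (lookup π j))) (pointwise j) in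
             Equivalence.from T-∧ ( Equivalence.from (bounded⇔ π) (All.tabulate (λ {y} y∈W → proj₁ (at-j y) y∈W))
                                  , Equivalence.from (peaksAt⇔ u π) (proj₂ (at-j u) refl)))
      (λ h → let (b , p) = Equivalence.to T-∧ h in
             Equivalence.from (fitsᵛ⇔ (slot u) π) λ j →
               Equivalence.from (slot-fits⇔ j (toℕ (lookup π j)))
                 ( All.lookup (Equivalence.to (bounded⇔ π) b)
                 , λ { refl → Equivalence.to (peaksAt⇔ u π) p }))

    private
      countᶠ : Slot → ℕ
      countᶠ t = ∑ (allFin n) (λ j → 𝟙 (slot u j ==ᵗ t))

    count-peak : count peak (slot u) ≡ 1
    count-peak = trans (count≡∑ peak (slot u))
                       (trans (∑-cong (allFin n) pointwise) (∑-𝟙-≟ Fin._≟_ (allFin⁺ n) (∈-allFin u)))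
      where
      pointwise : ∀ j → 𝟙 (slot u j ==ᵗ peak) ≡ 𝟙 (does (j Fin.≟ u))
      pointwise j with DecMembership._∈?_ Fin._≟_ j W | j Fin.≟ u
      ... | yes _   | yes _    = refl
      ... | yes _   | no  _    = refl
      ... | no  j∉W | yes refl = contradiction u∈W j∉W
      ... | no  _   | no  _    = refl

    count-peak+low : Unique W → count peak (slot u) + count low (slot u) ≡ length W
    count-peak+low uW = begin
      count peak (slot u) + count low (slot u)
        ≡⟨ cong₂ _+_ (count≡∑ peak (slot u)) (count≡∑ low (slot u)) ⟩
      countᶠ peak + countᶠ low
        ≡⟨ sym (∑-+ (allFin n) _ _) ⟩
      ∑ (allFin n) (λ j → 𝟙 (slot u j ==ᵗ peak) + 𝟙 (slot u j ==ᵗ low))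
        ≡⟨ ∑-cong (allFin n) pointwise ⟩
      ∑ (allFin n) (λ j → 𝟙 (j ∈ᵇ W))
        ≡⟨ ∑-𝟙-∈? Fin._≟_ (allFin⁺ n) uW (λ {y} _ → ∈-allFin y) ⟩
      length W ∎
      where
      open ≡-Reasoning
      pointwise : ∀ j → 𝟙 (slot u j ==ᵗ peak) + 𝟙 (slot u j ==ᵗ low) ≡ 𝟙 (j ∈ᵇ W)
      pointwise j with DecMembership._∈?_ Fin._≟_ j W | j Fin.≟ u
      ... | yes _ | yes _ = refl
      ... | yes _ | no  _ = refl
      ... | no  _ | _     = refl

    count-total : count peak (slot u) + count low (slot u) + count free (slot u) ≡ n
    count-total = begin
      count peak (slot u) + count low (slot u) + count free (slot u)
        ≡⟨ cong₂ _+_ (cong₂ _+_ (count≡∑ peak (slot u)) (count≡∑ low (slot u))) (count≡∑ free (slot u)) ⟩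
      countᶠ peak + countᶠ low + countᶠ free
        ≡⟨ sym (trans (∑-+ (allFin n) _ _) (cong (_+ countᶠ free) (∑-+ (allFin n) _ _))) ⟩
      ∑ (allFin n) (λ j → 𝟙 (slot u j ==ᵗ peak) + 𝟙 (slot u j ==ᵗ low) + 𝟙 (slot u j ==ᵗ free))
        ≡⟨ ∑-cong (allFin n) (λ j → pointwise (slot u j)) ⟩
      ∑ (allFin n) (λ _ → 1)
        ≡⟨ trans (∑-const (allFin n) 1) (trans (*-identityʳ _) (length-tabulate (λ i → i))) ⟩
      n ∎
      where
      open ≡-Reasoning
      pointwise : ∀ t → 𝟙 (t ==ᵗ peak) + 𝟙 (t ==ᵗ low) + 𝟙 (t ==ᵗ free) ≡ 1
      pointwise peak = refl
      pointwise low  = refl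
      pointwise free = refl

    pattern-count : Unique W → ℓ < n →
      ∑ (Sn n) (λ π → 𝟙 (bounded π ∧ peaksAt u π)) ≡ (ℓ P (length W ∸ 1)) * (n ∸ length W) !
    pattern-count uW ℓ<n = begin
      ∑ (Sn n) (λ π → 𝟙 (bounded π ∧ peaksAt u π))
        ≡⟨ ∑-Sn {n} (λ π → 𝟙 (bounded π ∧ peaksAt u π)) ⟩
      ∑ (allVecs n n) (λ v → 𝟙 (fresh [] v) * 𝟙 (bounded v ∧ peaksAt u v))
        ≡⟨ ∑-cong (allVecs n n) (λ v → trans (sym (𝟙-∧ (fresh [] v) _))
                                             (cong (λ b → 𝟙 (fresh [] v ∧ b)) (sym (fitsᵛ-slot v)))) ⟩
      arrangements (slot u) []
        ≡⟨ arrangements≡arr₃ (slot u) [] ⟩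
      arr₃ (count peak (slot u)) (count low (slot u)) (count free (slot u)) (avail [] below) (avail [] at) (avail [] above)
        ≡⟨ arr₃-cong count-peak count-low count-free
                     (trans (avail[] below) (sideCount-below n ℓ (<⇒≤ ℓ<n)))
                     (trans (avail[] at) (sideCount-at n ℓ ℓ<n))
                     (trans (avail[] above) (sideCount-above n ℓ ℓ<n)) ⟩
      1 * arr₂ ℓ (n ∸ suc ℓ) (k ∸ 1) (n ∸ k)
        ≡⟨ trans (*-identityˡ _) (arr₂-closed ℓ (n ∸ suc ℓ) (k ∸ 1) (n ∸ k)) ⟩
      ℓ ↓ (k ∸ 1) * (ℓ + (n ∸ suc ℓ) ∸ (k ∸ 1)) ↓ (n ∸ k)
        ≡⟨ cong₂ _*_ (↓≡P ℓ (k ∸ 1))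
                     (trans (cong (_↓ (n ∸ k)) (∸-telescope ℓ<n (∈⇒0<length u∈W)))
                            (trans (↓≡P (n ∸ k) (n ∸ k)) (nPn≡n! (n ∸ k)))) ⟩
      (ℓ P (k ∸ 1)) * (n ∸ k) ! ∎
      where
      open ≡-Reasoning
      k = length W
      count-low : count low (slot u) ≡ k ∸ 1
      count-low = trans (sym (m+n∸m≡n 1 _))
                        (cong (_∸ 1) (trans (cong (_+ count low (slot u)) (sym count-peak)) (count-peak+low uW)))
      count-free : count free (slot u) ≡ n ∸ k
      count-free = trans (sym (m+n∸m≡n k _))
                         (cong (_∸ k) (trans (cong (_+ count free (slot u)) (sym (count-peak+low uW))) count-total))
      avail[] : ∀ s → avail [] s ≡ sideCount n ℓ s
      avail[] s = ∑-cong (allFin n) (λ x → cong 𝟙 (∧-identityʳ (σ x ==ˢ s)))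
      ∈⇒0<length : ∀ {xs : List (Fin n)} → u ∈ xs → 0 < length xs
      ∈⇒0<length {_ ∷ _} _ = s≤s z≤n
      ∸-telescope : ∀ {n ℓ k} → ℓ < n → 0 < k → ℓ + (n ∸ suc ℓ) ∸ (k ∸ 1) ≡ n ∸ k
      ∸-telescope {suc n} {ℓ} {suc k} (s≤s ℓ≤n) _ = cong (_∸ k) (m+[n∸m]≡n ℓ≤n)

-- Tuples covering a window

module Coverings (n ℓ : ℕ) (W : List (Fin n)) where
  open PatternCount n ℓ W using (bounded; peaksAt)

  peaks? : (π : Vec (Fin n) n) → Decidable (λ u → toℕ (lookup π u) ≡ ℓ)
  peaks? π u = toℕ (lookup π u) ℕ.≟ ℓ

  unhit : Vec (Fin n) n → List (Fin n) → List (Fin n)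
  unhit π = filter (∁? (peaks? π))

  covers : ∀ {r} → Vec (Vec (Fin n) n) r → List (Fin n) → Bool
  covers []      S = null S
  covers (π ∷ Π) S = bounded π ∧ covers Π (unhit π S)

  coverings : ℕ → List (Fin n) → ℕ
  coverings r S = ∑ (tuples r (Sn n)) (λ Π → 𝟙 (covers Π S))

  coverings-step : ∀ r S → coverings (suc r) S ≡ ∑ (Sn n) (λ π → 𝟙 (bounded π) * coverings r (unhit π S))
  coverings-step r S =
    trans (∑-concatMap (Sn n) (tuples r (Sn n)) _∷_ (λ Π → 𝟙 (covers Π S)))
          (∑-cong (Sn n) λ π →
            trans (∑-cong (tuples r (Sn n)) (λ Π → 𝟙-∧ (bounded π) (covers Π (unhit π S))))
                  (∑-*ˡ (tuples r (Sn n)) (𝟙 (bounded π)) (λ Π → 𝟙 (covers Π (unhit π S)))))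

  hits : Vec (Fin n) n → List (Fin n) → ℕ
  hits π S = length (filter (peaks? π) S)

  hits≤1 : ∀ {π} → π ∈ Sn n → ∀ {S} → Unique S → hits π S ≤ 1
  hits≤1 {π} π∈Sn {S} uS =
    length≤1-of-fiber (λ eq → Sn-injective π∈Sn _ _ (Fin.toℕ-injective eq))
                      (filter⁺ (peaks? π) uS) (all-filter (peaks? π) S)

  length-unhit : ∀ {π} → π ∈ Sn n → ∀ {S} → Unique S → length S ≤ suc (length (unhit π S))
  length-unhit {π} π∈Sn {S} uS = begin
    length S                          ≡⟨ sym (length-filter+∁ (peaks? π) S) ⟩
    hits π S + length (unhit π S)     ≤⟨ +-monoˡ-≤ _ (hits≤1 π∈Sn uS) ⟩
    suc (length (unhit π S))          ∎
    where open ≤-Reasoning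

  coverings-vanish : ∀ r {S} → Unique S → r < length S → coverings r S ≡ 0
  coverings-vanish zero    {_ ∷ _} _  _   = refl
  coverings-vanish (suc r) {S}     uS r<S =
    trans (coverings-step r S) (trans (∑-cong-∈ (Sn n) vanishes) (∑-zero (Sn n)))
    where
    vanishes : ∀ {π} → π ∈ Sn n → 𝟙 (bounded π) * coverings r (unhit π S) ≡ 0
    vanishes {π} π∈Sn =
      trans (cong (𝟙 (bounded π) *_)
                  (coverings-vanish r (filter⁺ _ uS) (s≤s⁻¹ (≤-trans r<S (length-unhit π∈Sn uS)))))
            (*-zeroʳ (𝟙 (bounded π)))

  module _ {N : ℕ} (pattern≡N : ∀ {u} → u ∈ W → ∑ (Sn n) (λ π → 𝟙 (bounded π ∧ peaksAt u π)) ≡ N)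
    where

    -- A permutation takes the value ℓ at most once, so when r + 1 permutations cover r + 1
    -- positions, the first one covers exactly one of them.
    coverings-closed : ∀ r {S} → Unique S → (∀ {u} → u ∈ S → u ∈ W) → length S ≡ r →
      coverings r S ≡ r ! * N ^ r
    coverings-closed zero    {[]} _  _    _     = refl
    coverings-closed (suc r) {S}  uS S⊆W ∣S∣≡ = begin
      coverings (suc r) S
        ≡⟨ coverings-step r S ⟩
      ∑ (Sn n) (λ π → 𝟙 (bounded π) * coverings r (unhit π S))
        ≡⟨ ∑-cong-∈ (Sn n) per-permutation ⟩
      ∑ (Sn n) (λ π → M * ∑ S (λ u → 𝟙 (bounded π ∧ peaksAt u π)))
        ≡⟨ ∑-*ˡ (Sn n) M _ ⟩
      M * ∑ (Sn n) (λ π → ∑ S (λ u → 𝟙 (bounded π ∧ peaksAt u π)))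
        ≡⟨ cong (M *_) (∑-swap (Sn n) S (λ π u → 𝟙 (bounded π ∧ peaksAt u π))) ⟩
      M * ∑ S (λ u → ∑ (Sn n) (λ π → 𝟙 (bounded π ∧ peaksAt u π)))
        ≡⟨ cong (M *_) (trans (∑-cong-∈ S (pattern≡N ∘ S⊆W)) (∑-const S N)) ⟩
      M * (length S * N)
        ≡⟨ cong (λ k → M * (k * N)) ∣S∣≡ ⟩
      r ! * N ^ r * (suc r * N)
        ≡⟨ factorial-power r (r !) (N ^ r) N ⟩
      suc r ! * N ^ suc r ∎
      where
      open ≡-Reasoning
      M = r ! * N ^ r
      factorial-power : ∀ r f p N → f * p * (suc r * N) ≡ (suc r * f) * (N * p)
      factorial-power = solve-∀
      unhit≡ : ∀ {π} → π ∈ Sn n → coverings r (unhit π S) ≡ hits π S * M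
      unhit≡ {π} π∈Sn with hits π S | length-filter+∁ (peaks? π) S | hits≤1 π∈Sn uS
      ... | zero     | ∣unhit∣≡ | _ =
        coverings-vanish r (filter⁺ _ uS) (≤-reflexive (sym (trans ∣unhit∣≡ ∣S∣≡)))
      ... | suc zero | ∣unhit∣≡ | _ = trans
        (coverings-closed r (filter⁺ _ uS) (S⊆W ∘ proj₁ ∘ ∈-filter⁻ _)
                            (suc-injective (trans ∣unhit∣≡ ∣S∣≡)))
        (sym (+-identityʳ M))
      ... | suc (suc _) | _ | s≤s ()
      per-permutation : ∀ {π} → π ∈ Sn n →
        𝟙 (bounded π) * coverings r (unhit π S) ≡ M * ∑ S (λ u → 𝟙 (bounded π ∧ peaksAt u π))
      per-permutation {π} π∈Sn = begin
        𝟙 (bounded π) * coverings r (unhit π S)   ≡⟨ cong (𝟙 (bounded π) *_) (unhit≡ π∈Sn) ⟩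
        𝟙 (bounded π) * (hits π S * M)            ≡⟨ x*[y*z]≡z*[x*y] (𝟙 (bounded π)) (hits π S) M ⟩
        M * (𝟙 (bounded π) * hits π S)
          ≡⟨ cong (λ h → M * (𝟙 (bounded π) * h)) (length-filter-∑ (peaks? π) S) ⟩
        M * (𝟙 (bounded π) * ∑ S (λ u → 𝟙 (peaksAt u π)))
          ≡⟨ cong (M *_) (sym (trans (∑-cong S (λ u → 𝟙-∧ (bounded π) (peaksAt u π)))
                                     (∑-*ˡ S (𝟙 (bounded π)) (λ u → 𝟙 (peaksAt u π))))) ⟩
        M * ∑ S (λ u → 𝟙 (bounded π ∧ peaksAt u π)) ∎
        where
        x*[y*z]≡z*[x*y] : ∀ x y z → x * (y * z) ≡ z * (x * y)
        x*[y*z]≡z*[x*y] = solve-∀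

-- Levels

module _ {n : ℕ} where

  private
    Hit : ℕ → Fin n → Vec (Fin n) n → Set
    Hit ℓ y π = toℕ (lookup π y) ≡ ℓ

  lev≤⇔ : ∀ {r} (Π : Vec (Vec (Fin n) n) r) y ℓ →
    lev Π y ≤ ℓ ⇔ VecAll.All (λ π → toℕ (lookup π y) ≤ ℓ) Π
  lev≤⇔ []      y ℓ = mk⇔ (λ _ → VecAll.[]) (λ _ → z≤n)
  lev≤⇔ (π ∷ Π) y ℓ = mk⇔
    (λ h → m⊔n≤o⇒m≤o _ _ h VecAll.∷ Equivalence.to (lev≤⇔ Π y ℓ) (m⊔n≤o⇒n≤o _ _ h))
    (λ h → ⊔-lub (VecAll.head h) (Equivalence.from (lev≤⇔ Π y ℓ) (VecAll.tail h)))

  hit⇒≤lev : ∀ {r} {Π : Vec (Vec (Fin n) n) r} {y ℓ} → VecAny.Any (Hit ℓ y) Π → ℓ ≤ lev Π y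
  hit⇒≤lev {Π = π ∷ Π} (here refl) = m≤m⊔n _ _
  hit⇒≤lev {Π = π ∷ Π} (there h)   = ≤-trans (hit⇒≤lev h) (m≤n⊔m _ _)

  lev-attained : ∀ {r} π (Π : Vec (Vec (Fin n) n) r) y → VecAny.Any (Hit (lev (π ∷ Π) y) y) (π ∷ Π)
  lev-attained π []        y = here (sym (⊔-identityʳ _))
  lev-attained π (π′ ∷ Π) y with ⊔-sel (toℕ (lookup π y)) (lev (π′ ∷ Π) y)
  ... | inj₁ ≡left  = here (sym ≡left)
  ... | inj₂ ≡right =
    there (subst (λ ℓ → VecAny.Any (Hit ℓ y) (π′ ∷ Π)) (sym ≡right) (lev-attained π′ Π y))

  lev≡⇔ : ∀ {r} π (Π : Vec (Vec (Fin n) n) r) y ℓ →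
    lev (π ∷ Π) y ≡ ℓ ⇔ (lev (π ∷ Π) y ≤ ℓ × VecAny.Any (Hit ℓ y) (π ∷ Π))
  lev≡⇔ π Π y ℓ = mk⇔
    (λ { refl → ≤-refl , lev-attained π Π y })
    (λ (≤ℓ , hit) → ≤-antisym ≤ℓ (hit⇒≤lev hit))

  lev<n : ∀ {r} (Π : Vec (Vec (Fin n) n) r) y → lev Π y < n
  lev<n []      y = ≤-trans (s≤s z≤n) (Fin.toℕ<n y)
  lev<n (π ∷ Π) y = ⊔-lub (Fin.toℕ<n (lookup π y)) (lev<n Π y)

  module _ (ℓ : ℕ) (W : List (Fin n)) where
    open PatternCount n ℓ W using (bounded; bounded⇔)
    open Coverings n ℓ W

    covers⇔ : ∀ {r} (Π : Vec (Vec (Fin n) n) r) S →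
      T (covers Π S) ⇔ (VecAll.All (T ∘ bounded) Π × All (λ u → VecAny.Any (Hit ℓ u) Π) S)
    covers⇔ []      []      = mk⇔ (λ _ → VecAll.[] , []) (λ _ → tt)
    covers⇔ []      (u ∷ S) = mk⇔ (λ ()) (λ { (_ , () ∷ _) })
    covers⇔ (π ∷ Π) S = mk⇔
      (λ h → let (bπ , rest) = Equivalence.to T-∧ h
                 (bΠ , hits) = Equivalence.to (covers⇔ Π (unhit π S)) rest in
             bπ VecAll.∷ bΠ , All.tabulate (λ {u} u∈S → hit-or-unhit u u∈S hits))
      (λ (bπΠ , hits) → Equivalence.from T-∧
             ( VecAll.head bπΠ
             , Equivalence.from (covers⇔ Π (unhit π S))
                 (VecAll.tail bπΠ , All.tabulate (λ u∈unhit → still-needed u∈unhit hits))))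
      where
      hit-or-unhit : ∀ u → u ∈ S →
        All (λ u → VecAny.Any (Hit ℓ u) Π) (unhit π S) → VecAny.Any (Hit ℓ u) (π ∷ Π)
      hit-or-unhit u u∈S hits with peaks? π u
      ... | yes hit = here hit
      ... | no  miss = there (All.lookup hits (∈-filter⁺ _ u∈S miss))
      still-needed : ∀ {u} → u ∈ unhit π S →
        All (λ u → VecAny.Any (Hit ℓ u) (π ∷ Π)) S → VecAny.Any (Hit ℓ u) Π
      still-needed u∈unhit hits with ∈-filter⁻ _ u∈unhit
      ... | u∈S , miss with All.lookup hits u∈S
      ...   | here hit = contradiction hit miss
      ...   | there h  = h

    bounded-all⇔ : ∀ {r} (Π : Vec (Vec (Fin n) n) r) →
      VecAll.All (T ∘ bounded) Π ⇔ All (λ y → lev Π y ≤ ℓ) W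
    bounded-all⇔ []      = mk⇔ (λ _ → All.universal (λ _ → z≤n) W) (λ _ → VecAll.[])
    bounded-all⇔ (π ∷ Π) = mk⇔
      (λ h → All.zipWith (λ (π≤ , Π≤) → ⊔-lub π≤ Π≤)
               (Equivalence.to (bounded⇔ π) (VecAll.head h) , Equivalence.to (bounded-all⇔ Π) (VecAll.tail h)))
      (λ h → Equivalence.from (bounded⇔ π) (All.map (λ {y} → m⊔n≤o⇒m≤o (toℕ (lookup π y)) _) h)
             VecAll.∷ Equivalence.from (bounded-all⇔ Π) (All.map (λ {y} → m⊔n≤o⇒n≤o (toℕ (lookup π y)) _) h))

    atLevel : ∀ {r} → Vec (Vec (Fin n) n) r → Bool
    atLevel Π = does (all? (λ y → lev Π y ℕ.≟ ℓ) W)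

    covers≡atLevel : ∀ {r} π (Π : Vec (Vec (Fin n) n) r) → covers (π ∷ Π) W ≡ atLevel (π ∷ Π)
    covers≡atLevel π Π = T-ext
      (λ h → let (bnd , hits) = Equivalence.to (covers⇔ (π ∷ Π) W) h
                 lev≤ = Equivalence.to (bounded-all⇔ (π ∷ Π)) bnd in
             Equivalence.from (T-does⇔ (all? (λ y → lev (π ∷ Π) y ℕ.≟ ℓ) W))
               (All.zipWith (Equivalence.from (lev≡⇔ π Π _ ℓ)) (lev≤ , hits)))
      (λ h → let levs = Equivalence.to (T-does⇔ (all? (λ y → lev (π ∷ Π) y ℕ.≟ ℓ) W)) h
                 (lev≤ , hits) = All.unzip (All.map (Equivalence.to (lev≡⇔ π Π _ ℓ)) levs) in
             Equivalence.from (covers⇔ (π ∷ Π) W) (Equivalence.from (bounded-all⇔ (π ∷ Π)) lev≤ , hits))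

  allEqual≡∑atLevel : ∀ {r} (Π : Vec (Vec (Fin n) n) r) w W′ →
    𝟙 (allEqual (map (lev Π) (w ∷ W′))) ≡ ∑ (upTo n) (λ ℓ → 𝟙 (atLevel ℓ (w ∷ W′) Π))
  allEqual≡∑atLevel Π w W′ = sym (begin
    ∑ (upTo n) (λ ℓ → 𝟙 (does (L ℕ.≟ ℓ) ∧ rest ℓ))  ≡⟨ ∑-cong (upTo n) pointwise ⟩
    ∑ (upTo n) (λ ℓ → 𝟙 (does (ℓ ℕ.≟ L)) * 𝟙 E)     ≡⟨ ∑-*ʳ (upTo n) (𝟙 E) _ ⟩
    ∑ (upTo n) (λ ℓ → 𝟙 (does (ℓ ℕ.≟ L))) * 𝟙 E
      ≡⟨ cong (_* 𝟙 E) (∑-𝟙-≟ ℕ._≟_ (upTo⁺ n) (∈-upTo⁺ (lev<n Π w))) ⟩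
    1 * 𝟙 E                                         ≡⟨ *-identityˡ (𝟙 E) ⟩
    𝟙 E ∎)
    where
    open ≡-Reasoning
    L = lev Π w
    rest : ℕ → Bool
    rest ℓ = does (all? (λ y → lev Π y ℕ.≟ ℓ) W′)
    E = allEqual (map (lev Π) (w ∷ W′))
    pointwise : ∀ ℓ → 𝟙 (does (L ℕ.≟ ℓ) ∧ rest ℓ) ≡ 𝟙 (does (ℓ ℕ.≟ L)) * 𝟙 E
    pointwise ℓ with L ℕ.≟ ℓ
    ... | yes refl rewrite dec-true (L ℕ.≟ L) refl =
      trans (sym (cong 𝟙 (all?-map (λ y → y ℕ.≟ L) (lev Π) W′))) (sym (+-identityʳ _))
    ... | no  L≢ℓ  rewrite dec-false (L ℕ.≟ ℓ) L≢ℓ | dec-false (ℓ ℕ.≟ L) (L≢ℓ ∘ sym) = refl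

-- Plateaux

window-count : ∀ n k (W : List (Fin n)) → Unique W → length W ≡ suc k →
  ∑ (tuples (suc k) (Sn n)) (λ Π → 𝟙 (allEqual (map (lev Π) W)))
    ≡ suc k ! * ((n ∸ suc k) !) ^ suc k * ∑ (upTo n) (λ ℓ → (ℓ P k) ^ suc k)
window-count n k W@(w ∷ W′) uW ∣W∣≡ = begin
  ∑ Tuples (λ Π → 𝟙 (allEqual (map (lev Π) W)))
    ≡⟨ ∑-cong Tuples (λ Π → allEqual≡∑atLevel Π w W′) ⟩
  ∑ Tuples (λ Π → ∑ (upTo n) (λ ℓ → 𝟙 (atLevel ℓ W Π)))
    ≡⟨ ∑-swap Tuples (upTo n) (λ Π ℓ → 𝟙 (atLevel ℓ W Π)) ⟩
  ∑ (upTo n) (λ ℓ → ∑ Tuples (λ Π → 𝟙 (atLevel ℓ W Π)))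
    ≡⟨ ∑-cong-∈ (upTo n) (λ ℓ∈ → count-at-level (∈-upTo⁻ ℓ∈)) ⟩
  ∑ (upTo n) (λ ℓ → suc k ! * F ^ suc k * (ℓ P k) ^ suc k)
    ≡⟨ ∑-*ˡ (upTo n) (suc k ! * F ^ suc k) _ ⟩
  suc k ! * F ^ suc k * ∑ (upTo n) (λ ℓ → (ℓ P k) ^ suc k) ∎
  where
  open ≡-Reasoning
  Tuples = tuples (suc k) (Sn n)
  F = (n ∸ suc k) !
  count-at-level : ∀ {ℓ} → ℓ < n →
    ∑ Tuples (λ Π → 𝟙 (atLevel ℓ W Π)) ≡ suc k ! * F ^ suc k * (ℓ P k) ^ suc k
  count-at-level {ℓ} ℓ<n = begin
    ∑ Tuples (λ Π → 𝟙 (atLevel ℓ W Π))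
      ≡⟨ ∑-cong Tuples (λ { (π ∷ Π) → cong 𝟙 (sym (covers≡atLevel ℓ W π Π)) }) ⟩
    coverings (suc k) W
      ≡⟨ coverings-closed (λ u∈W → pattern-count u∈W uW ℓ<n) (suc k) uW (λ u∈W → u∈W) ∣W∣≡ ⟩
    suc k ! * ((ℓ P (length W ∸ 1)) * (n ∸ length W) !) ^ suc k
      ≡⟨ cong (λ m → suc k ! * ((ℓ P (m ∸ 1)) * (n ∸ m) !) ^ suc k) ∣W∣≡ ⟩
    suc k ! * ((ℓ P k) * F) ^ suc k
      ≡⟨ cong (suc k ! *_) (^-distribʳ-* (ℓ P k) F (suc k)) ⟩
    suc k ! * ((ℓ P k) ^ suc k * F ^ suc k)
      ≡⟨ regroup (suc k !) ((ℓ P k) ^ suc k) (F ^ suc k) ⟩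
    suc k ! * F ^ suc k * (ℓ P k) ^ suc k ∎
    where
    open Coverings n ℓ W
    open PatternCount n ℓ W
    regroup : ∀ x y z → x * (y * z) ≡ x * z * y
    regroup = solve-∀

window : ∀ {n} → ℕ → ℕ → List (Fin n)
window {n} k i = take k (drop i (allFin n))

plateaux≡∑windows : ∀ n k (Π : Vec (Vec (Fin n) n) (suc k)) →
  plateaux n (suc (suc k)) Π ≡ ∑ (upTo ((n + 1) ∸ suc k)) (λ i → 𝟙 (allEqual (map (lev Π) (window (suc k) i))))
plateaux≡∑windows n k Π =
  trans (length-filter-∑ (λ i → Bool._≟_ (allEqual (take (suc k) (drop i (levels Π)))) true) (upTo ((n + 1) ∸ suc k)))
        (∑-cong (upTo ((n + 1) ∸ suc k)) λ i →
          cong 𝟙 (trans (does-≟-true _)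
                        (cong allEqual (trans (cong (take (suc k)) (drop-map i (allFin n))) (take-map (suc k) _)))))
  where
  does-≟-true : ∀ b → does (Bool._≟_ b true) ≡ b
  does-≟-true true  = refl
  does-≟-true false = refl

window-length : ∀ n k i → i < (n + 1) ∸ k → length (window {n} k i) ≡ k
window-length n k i i<m = begin-equality
  length (window {n} k i)       ≡⟨ length-take k _ ⟩
  k ⊓ length (drop i (allFin n))
    ≡⟨ cong (k ⊓_) (trans (length-drop i (allFin n)) (cong (_∸ i) (length-tabulate (λ j → j)))) ⟩
  k ⊓ (n ∸ i)                    ≡⟨ m≤n⇒m⊓n≡m (m+n≤o⇒m≤o∸n k (subst (_≤ n) (+-comm i k) i+k≤n)) ⟩
  k                              ∎
  where
  open ≤-Reasoning
  k≤n+1 : k ≤ n + 1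
  k≤n+1 = <⇒≤ (m∸n≢0⇒n<m (λ m≡0 → <⇒≢ (≤-trans (s≤s z≤n) i<m) (sym m≡0)))
  i+k≤n : i + k ≤ n
  i+k≤n = s≤s⁻¹ (subst (suc i + k ≤_) (+-comm n 1) (m≤o∸n⇒m+n≤o (suc i) k≤n+1 i<m))

total-plateaux : ∀ n k → totalPlateaux n (suc (suc k))
  ≡ ((n + 1) ∸ suc k) * (suc k ! * ((n ∸ suc k) !) ^ suc k * ∑ (upTo n) (λ ℓ → (ℓ P k) ^ suc k))
total-plateaux n k = begin
  ∑ Tuples (plateaux n (suc (suc k)))
    ≡⟨ ∑-cong Tuples (plateaux≡∑windows n k) ⟩
  ∑ Tuples (λ Π → ∑ (upTo m) (λ i → 𝟙 (allEqual (map (lev Π) (window (suc k) i)))))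
    ≡⟨ ∑-swap Tuples (upTo m) _ ⟩
  ∑ (upTo m) (λ i → ∑ Tuples (λ Π → 𝟙 (allEqual (map (lev Π) (window (suc k) i)))))
    ≡⟨ ∑-cong-∈ (upTo m) (λ {i} i∈ →
         window-count n k (window (suc k) i) (take⁺ (suc k) (drop⁺ i (allFin⁺ n)))
                      (window-length n (suc k) i (∈-upTo⁻ i∈))) ⟩
  ∑ (upTo m) (λ _ → C)
    ≡⟨ trans (∑-const (upTo m) C) (cong (_* C) (length-upTo m)) ⟩
  m * C ∎
  where
  open ≡-Reasoning
  Tuples = tuples (suc k) (Sn n)
  m = (n + 1) ∸ suc k
  C = suc k ! * ((n ∸ suc k) !) ^ suc k * ∑ (upTo n) (λ ℓ → (ℓ P k) ^ suc k)

theorem3p15 : (n d : ℕ) → 2 ≤ n → 2 ≤ d → d ∸ 1 ≤ n →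
    totalPlateaux n d
      ≡ ((n + 2) ∸ d) * ((d ∸ 1) !) * ((((n + 1) ∸ d) !) ^ (d ∸ 1))
          * sum (map (λ ℓ → (A ℓ (d ∸ 2)) ^ (d ∸ 1)) (upTo n))
theorem3p15 n (suc zero)    _ (s≤s ()) _
theorem3p15 n (suc (suc k)) _ _        _ = begin
  totalPlateaux n (suc (suc k))
    ≡⟨ total-plateaux n k ⟩
  ((n + 1) ∸ suc k) * (suc k ! * F ^ suc k * S)
    ≡⟨ reassociate ((n + 1) ∸ suc k) (suc k !) (F ^ suc k) S ⟩
  ((n + 1) ∸ suc k) * suc k ! * F ^ suc k * S
    ≡⟨ cong₂ (λ m f → m * suc k ! * (f !) ^ suc k * S)
             (trans (cong (_∸ suc k) (+-comm n 1)) (sym (cong (_∸ suc (suc k)) (+-comm n 2))))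
             (sym (cong (_∸ suc (suc k)) (+-comm n 1))) ⟩
  ((n + 2) ∸ suc (suc k)) * suc k ! * (((n + 1) ∸ suc (suc k)) !) ^ suc k * S ∎
  where
  open ≡-Reasoning
  F = (n ∸ suc k) !
  S = ∑ (upTo n) (λ ℓ → (ℓ P k) ^ suc k)
  reassociate : ∀ m f p s → m * (f * p * s) ≡ m * f * p * s
  reassociate = solve-∀
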